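{- For every integer $m\ge 2$ and every positive integer $k$, $$\chi^b_{B_m^1}(2k)=\Big[\sum_{i=0}^{m-2}(-1)^i(2k-1)^{(m-2)-i}\Big]\chi^b_{C_2^- }(2k).$$
   Context: A signed graph $(G,\sigma)$ is a finite graph $G$ (parallel edges allowed) with a sign function $\sigma:E(G)\to\{+1,-1\}$. A zero-free signed coloring in $2k$ colors is a map $c:V(G)\to\{ -k,\dots,-1,1,\dots,k\}$; it is proper if $c(y)\neq\sigma(e)c(x)$ for every edge $e=xy$. The balanced chromatic polynomial $\chi^b_{(G,\sigma)}(2k)$ is the number of proper zero-free signed colorings in $2k$ colors. $C_2^-$ is the signed graph on two vertices $u,v$ joined by two parallel edges, one positive and one negative. For $m\ge 3$, $B_m^1$ is the signed graph consisting of $C_2^-$ on $u,v$ together with a path $u\,u_1\,u_2\cdots u_{m-2}\,v$ of positive edges through $m-2$ new vertices. By convention $B_2^1:=C_2^-$. -}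

module Defs where

open import Data.Nat using (ℕ; zero; suc; _+_; _∸_; _*_)
open import Data.Fin using (Fin; zero; suc; toℕ; fromℕ<)
open import Data.Bool using (Bool; true; false)
open import Data.Integer as ℤ using (ℤ; +_; -_)

import Data.List
open import Data.List using (List; []; _∷_; map; concatMap; filter; length; allFin; _++_; upTo)
open import Data.List.Relation.Unary.All using (All; all?)
open import Data.Product using (_×_; _,_; proj₁; proj₂)
open import Relation.Nullary using (¬_; Dec)
open import Relation.Nullary.Decidable using (¬?)
open import Relation.Binary.PropositionalEquality using (_≡_)

data Sign : Set where
  pos neg : Sign

-- A signed graph: finitely many vertices (Fin n), a finite list of edges
-- (parallel edges allowed); an edge (x , y , s) joins x and y with sign s.
record SignedGraph : Set where
  constructor mkSG
  field
    nV    : ℕ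
    edges : List (Fin nV × Fin nV × Sign)
open SignedGraph public

-- Zero-free colours in 2k colours: {-k,…,-1,1,…,k}.
-- (b , i) represents the integer ±(1 + toℕ i), sign + iff b = true.
Colour : ℕ → Set
Colour k = Bool × Fin k

colourValue : ∀ {k} → Colour k → ℤ
colourValue (true  , i) = + suc (toℕ i)
colourValue (false , i) = - (+ suc (toℕ i))

signAct : Sign → ℤ → ℤ
signAct pos z = z
signAct neg z = - z

allColours : (k : ℕ) → List (Colour k)
allColours k = map (true ,_) (allFin k) ++ map (false ,_) (allFin k)

allFuns : ∀ {A : Set} → List A → (n : ℕ) → List (Fin n → A)
allFuns as zero    = (λ ()) ∷ []
allFuns as (suc n) = concatMap (λ a → map (λ f → λ { zero → a ; (suc i) → f i }) (allFuns as n)) as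

ProperAt : ∀ {n k} → (Fin n → Colour k) → Fin n × Fin n × Sign → Set
ProperAt c (x , y , s) = ¬ (colourValue (c y) ≡ signAct s (colourValue (c x)))

properAt? : ∀ {n k} (c : Fin n → Colour k) (e : Fin n × Fin n × Sign) → Dec (ProperAt c e)
properAt? c (x , y , s) = ¬? (colourValue (c y) ℤ.≟ signAct s (colourValue (c x)))

Proper : ∀ {k} (G : SignedGraph) → (Fin (nV G) → Colour k) → Set
Proper G c = All (ProperAt c) (edges G)

proper? : ∀ {k} (G : SignedGraph) (c : Fin (nV G) → Colour k) → Dec (Proper G c)
proper? G c = all? (properAt? c) (edges G)

-- Balanced chromatic polynomial evaluated at 2k: number of proper
-- zero-free signed colourings in 2k colours.
balancedChrom : SignedGraph → (k : ℕ) → ℕ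
balancedChrom G k = length (filter (proper? G) (allFuns (allColours k) (nV G)))

C2⁻ : SignedGraph
C2⁻ = mkSG 2 ((zero , suc zero , pos) ∷ (zero , suc zero , neg) ∷ [])

-- B_m^1 with m = 2 + j: vertices u = 0, v = 1, and u_i = 1 + i (i = 1..j);
-- edges: C₂⁻ on u,v plus positive path u u_1 … u_j v.  For j = 0 it is C₂⁻.
-- pathEdges j lists the positive edges of the path u u_1 … u_j v, where
-- embed i sends path index i ∈ {0..j+1} to the corresponding vertex.
pathVertex : (j : ℕ) → ℕ → Fin (2 + j)
pathVertex j zero = zero
pathVertex j (suc i) with i Data.Nat.<? j
... | Relation.Nullary.yes p = fromℕ< {2 + i} (Data.Nat.s≤s (Data.Nat.s≤s p))
... | Relation.Nullary.no _  = suc zero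

pathEdges : (j : ℕ) → List (Fin (2 + j) × Fin (2 + j) × Sign)
pathEdges j = map (λ i → (pathVertex j i , pathVertex j (suc i) , pos)) (upTo (suc j))

B1 : ℕ → SignedGraph
B1 j = mkSG (2 + j) ((zero , suc zero , pos) ∷ (zero , suc zero , neg) ∷ pathEdges j)

B[_]¹ : (m : ℕ) → SignedGraph
B[ m ]¹ = B1 (m ∸ 2)

altSum : (k N : ℕ) → ℤ
altSum k N = Data.List.foldr ℤ._+_ (+ 0) (map (λ i → ((- (+ 1)) ℤ.^ i) ℤ.* ((+ (2 * k) ℤ.- + 1) ℤ.^ (N ∸ i))) (upTo (suc N)))

module Submission where

-- Write m = j + 2.  A colouring of B_m^1 is proper iff its values a, b at u, v
-- are proper for C₂⁻ (b ≠ ±a) and u, u₁, …, u_j, v is a walk in the complete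
-- graph on the 2k colours (consecutive colours distinct).  Hence
-- χ(B_m^1) = Σ_{a, b with b ≠ ±a} W_j(a, b), where W_j(a, b) counts such walks.
-- In a complete graph on N + 1 vertices, W_{j+1}(a, b) + W_j(a, b) is the number
-- N^{j+1} of all walks with j interior vertices ending at b; so for a ≠ b,
-- W_j(a, b) is the unique solution `walks` of this difference equation with
-- initial value 1, independent of a and b, and χ(B_m^1) = χ(C₂⁻) · walks.  The
-- alternating sum satisfies the same difference equation, which finishes it.

open import Defs
open import Data.Nat using (ℕ; _≥_; _∸_)
open import Data.Integer using (ℤ; +_; _*_)
open import Relation.Binary.PropositionalEquality using (_≡_)

open import Data.Nat as ℕ using (zero; suc; _+_; _<_; _<?_; s≤s)
import Data.Nat.Properties as ℕP
open import Data.Nat.ListAction using (sum)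
import Data.Integer as ℤ
import Data.Integer.Properties as ℤP
open import Data.Fin as Fin using (Fin; fromℕ<)
import Data.Fin.Properties as FinP
open import Data.Bool using (true; false)
import Data.Bool.Properties as BoolP
open import Data.List using (List; []; _∷_; _++_; map; filter; length; concatMap; upTo; allFin; foldr)
import Data.List.Properties as ListP
open import Data.List.Relation.Unary.All as All using (All; []; _∷_)
import Data.List.Relation.Unary.All.Properties as AllP
open import Data.Vec.Functional using () renaming (_∷_ to _∷ᶠ_)
open import Data.Product using (_×_; _,_; proj₁; proj₂)
open import Data.Product.Properties using (≡-dec; ,-injectiveʳ)
open import Data.Unit using (⊤; tt)
open import Data.Empty using (⊥-elim)
open import Relation.Nullary using (¬_; Dec; yes; no)
open import Relation.Nullary.Decidable using (¬?; _×-dec_)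
open import Relation.Unary using (Pred; Decidable; _≐_)
open import Relation.Binary.Definitions using (DecidableEquality)
open import Relation.Binary.PropositionalEquality using (_≢_; refl; sym; trans; cong; cong₂; subst; _≗_; module ≡-Reasoning)
open import Algebra.Definitions using (RightCancellative)
open import Algebra.Bundles using (AbelianGroup)
open import Algebra.Properties.CommutativeSemigroup ℕP.+-commutativeSemigroup using (interchange; x∙yz≈y∙xz)
import Algebra.Properties.Group as GroupProperties
open import Function using (_∘_; id; _⇔_; mk⇔; Equivalence)
open import Level using (0ℓ)

open Equivalence using (to; from)
module ℤ+ = GroupProperties (AbelianGroup.group ℤP.+-0-abelianGroup)

private
  variable
    A B : Set

count : {P : Pred A 0ℓ} → Decidable P → List A → ℕ
count P? xs = length (filter P? xs)

indicator : {R : Set} → Dec R → ℕ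
indicator (yes _) = 1
indicator (no _)  = 0

count-++ : {P : Pred A 0ℓ} (P? : Decidable P) (xs ys : List A) →
           count P? (xs ++ ys) ≡ count P? xs + count P? ys
count-++ P? xs ys = trans (cong length (ListP.filter-++ P? xs ys)) (ListP.length-++ (filter P? xs))

count-≐ : {P Q : Pred A 0ℓ} (P? : Decidable P) (Q? : Decidable Q) → P ≐ Q →
          (xs : List A) → count P? xs ≡ count Q? xs
count-≐ P? Q? P≐Q xs = cong length (ListP.filter-≐ P? Q? P≐Q xs)

count-map : {P : Pred B 0ℓ} (P? : Decidable P) (f : A → B) (xs : List A) →
            count P? (map f xs) ≡ count (P? ∘ f) xs
count-map P? f []       = refl
count-map P? f (x ∷ xs) with P? (f x)
... | yes _ = cong suc (count-map P? f xs)
... | no _  = count-map P? f xs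

count-concatMap : {P : Pred B 0ℓ} (P? : Decidable P) (f : A → List B) (xs : List A) →
                  count P? (concatMap f xs) ≡ sum (map (count P? ∘ f) xs)
count-concatMap P? f []       = refl
count-concatMap P? f (x ∷ xs) =
  trans (count-++ P? (f x) (concatMap f xs)) (cong (λ n → count P? (f x) + n) (count-concatMap P? f xs))

count-none : {P : Pred A 0ℓ} (P? : Decidable P) → (∀ x → ¬ P x) → (xs : List A) → count P? xs ≡ 0
count-none P? ¬P xs = cong length (ListP.filter-none P? (All.universal ¬P xs))

count-× : {R : Set} {S : Pred A 0ℓ} (R? : Dec R) (S? : Decidable S) (xs : List A) →
          count (λ x → R? ×-dec S? x) xs ≡ indicator R? ℕ.* count S? xs
count-× (yes r) S? xs = trans (count-≐ _ S? (proj₂ , (r ,_)) xs) (sym (ℕP.+-identityʳ (count S? xs)))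
count-× (no ¬r) S? xs = count-none _ (λ _ → ¬r ∘ proj₁) xs

module _ (_≟ᴬ_ : DecidableEquality A) (_≟ᴮ_ : DecidableEquality B) (f : A → B) where

  count-map-injective : (∀ {x y} → f x ≡ f y → x ≡ y) → (a : A) (xs : List A) →
                        count (_≟ᴮ f a) (map f xs) ≡ count (_≟ᴬ a) xs
  count-map-injective inj a xs =
    trans (count-map (_≟ᴮ f a) f xs) (count-≐ _ _ (inj , cong f) xs)

  count-map-outside : (b : B) → (∀ x → f x ≢ b) → (xs : List A) → count (_≟ᴮ b) (map f xs) ≡ 0
  count-map-outside b outside xs = trans (count-map (_≟ᴮ b) f xs) (count-none _ outside xs)

map-upTo-suc : (f : ℕ → A) (n : ℕ) → map f (upTo (suc n)) ≡ f 0 ∷ map (f ∘ suc) (upTo n)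
map-upTo-suc f n = cong (f 0 ∷_) (trans (ListP.map-applyUpTo suc f n) (sym (ListP.map-applyUpTo id (f ∘ suc) n)))

sum-map-+ : (f g : A → ℕ) (xs : List A) →
            sum (map (λ x → f x + g x) xs) ≡ sum (map f xs) + sum (map g xs)
sum-map-+ f g []       = refl
sum-map-+ f g (x ∷ xs) =
  trans (cong (λ n → f x + g x + n) (sum-map-+ f g xs))
        (interchange (f x) (g x) (sum (map f xs)) (sum (map g xs)))

sum-map-*ʳ : (f : A → ℕ) (c : ℕ) (xs : List A) →
             sum (map (λ x → f x ℕ.* c) xs) ≡ sum (map f xs) ℕ.* c
sum-map-*ʳ f c []       = refl
sum-map-*ʳ f c (x ∷ xs) =
  trans (cong (λ n → f x ℕ.* c + n) (sum-map-*ʳ f c xs))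
        (sym (ℕP.*-distribʳ-+ c (f x) (sum (map f xs))))

sum-const : (c : ℕ) (xs : List A) → sum (map (λ _ → c) xs) ≡ length xs ℕ.* c
sum-const c []       = refl
sum-const c (x ∷ xs) = cong (λ n → c + n) (sum-const c xs)

sum-indicator : {P : Pred A 0ℓ} (P? : Decidable P) (xs : List A) →
                sum (map (indicator ∘ P?) xs) ≡ count P? xs
sum-indicator P? []       = refl
sum-indicator P? (x ∷ xs) with P? x
... | yes _ = cong suc (sum-indicator P? xs)
... | no _  = sum-indicator P? xs

sum-except : (_≟_ : DecidableEquality A) (f : A → ℕ) (a : A) (xs : List A) →
             count (_≟ a) xs ℕ.* f a + sum (map (λ x → indicator (¬? (x ≟ a)) ℕ.* f x) xs)
               ≡ sum (map f xs)
sum-except _≟_ f a []       = ℕP.*-zeroʳ (count (_≟ a) [])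
sum-except _≟_ f a (x ∷ xs) with x ≟ a
... | yes refl = trans (ℕP.+-assoc (f a) _ _) (cong (λ n → f a + n) (sum-except _≟_ f a xs))
... | no _     = trans (x∙yz≈y∙xz (count (_≟ a) xs ℕ.* f a) (f x + 0) _)
                       (cong₂ _+_ (ℕP.+-identityʳ (f x)) (sum-except _≟_ f a xs))

-- A predicate on
-- functions is extensional if it respects pointwise equality; this is what
-- lets us identify the functions built by `allFuns` with `a ∷ᶠ g`.

Extensional : {n : ℕ} → Pred (Fin n → A) 0ℓ → Set
Extensional P = ∀ {c c'} → c ≗ c' → P c → P c'

∷ᶠ-ext : {n : ℕ} {P : Pred (Fin (suc n) → A) 0ℓ} → Extensional P → (a : A) →
         Extensional (λ g → P (a ∷ᶠ g))
∷ᶠ-ext resp a c≗c' = resp λ { Fin.zero → refl ; (Fin.suc i) → c≗c' i }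

count-allFuns-suc : {n : ℕ} {P : Pred (Fin (suc n) → A) 0ℓ} (P? : Decidable P) → Extensional P →
                    (xs : List A) →
                    count P? (allFuns xs (suc n)) ≡ sum (map (λ a → count (λ g → P? (a ∷ᶠ g)) (allFuns xs n)) xs)
count-allFuns-suc {n = n} P? resp xs =
  trans (count-concatMap P? _ xs) (cong sum (ListP.map-cong (λ a →
    -- the function that `allFuns` builds from a and f agrees pointwise with a ∷ᶠ f
    trans (count-map P? _ (allFuns xs n))
          (count-≐ _ _ (resp (λ { Fin.zero → refl ; (Fin.suc i) → refl }) ,
                        resp (λ { Fin.zero → refl ; (Fin.suc i) → refl })) (allFuns xs n))) xs))

count-allFuns-2+ : {n : ℕ} {P : Pred (Fin (2 + n) → A) 0ℓ} (P? : Decidable P) → Extensional P →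
                   {R : A → A → Set} (R? : ∀ a b → Dec (R a b))
                   {S : A → A → Pred (Fin n → A) 0ℓ} (S? : ∀ a b → Decidable (S a b)) →
                   (∀ a b → (λ g → P (a ∷ᶠ b ∷ᶠ g)) ≐ (λ g → R a b × S a b g)) → (xs : List A) →
                   count P? (allFuns xs (2 + n))
                     ≡ sum (map (λ a → sum (map (λ b → indicator (R? a b) ℕ.* count (S? a b) (allFuns xs n)) xs)) xs)
count-allFuns-2+ {n = n} P? resp R? S? split xs =
  trans (count-allFuns-suc P? resp xs) (cong sum (ListP.map-cong inner xs))
  where
  inner : ∀ a → count (λ g → P? (a ∷ᶠ g)) (allFuns xs (suc n))
                ≡ sum (map (λ b → indicator (R? a b) ℕ.* count (S? a b) (allFuns xs n)) xs)
  inner a = trans (count-allFuns-suc _ (∷ᶠ-ext resp a) xs) (cong sum (ListP.map-cong pair xs))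
    where
    pair : ∀ b → count (λ g → P? (a ∷ᶠ b ∷ᶠ g)) (allFuns xs n)
                 ≡ indicator (R? a b) ℕ.* count (S? a b) (allFuns xs n)
    pair b = trans (count-≐ _ (λ g → R? a b ×-dec S? a b g) (split a b) (allFuns xs n))
                   (count-× (R? a b) (S? a b) (allFuns xs n))

step-unique : {_∙_ : A → A → A} → RightCancellative _≡_ _∙_ → (f g : ℕ → A) → f 0 ≡ g 0 →
              (∀ j → f (suc j) ∙ f j ≡ g (suc j) ∙ g j) → ∀ j → f j ≡ g j
step-unique cancel f g base step zero    = base
step-unique {_∙_ = _∙_} cancel f g base step (suc j) =
  cancel (g j) (f (suc j)) (g (suc j))
         (trans (cong (f (suc j) ∙_) (sym (step-unique cancel f g base step j))) (step j))

-- walks r j is the number of walks with j interior vertices between two fixed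
-- distinct vertices of the complete graph on r + 2 vertices.  It is defined by
-- a subtraction-free recursion; `walks-step` is the defining difference equation.
walks : ℕ → ℕ → ℕ
walks r zero          = 1
walks r (suc zero)    = r
walks r (suc (suc j)) = r ℕ.* suc r ℕ.^ suc j + walks r j

walks-step : ∀ r j → walks r (suc j) + walks r j ≡ suc r ℕ.^ suc j
walks-step r zero    = trans (ℕP.+-comm r 1) (sym (ℕP.*-identityʳ (suc r)))
walks-step r (suc j) = begin
  r ℕ.* N + walks r j + walks r (suc j)    ≡⟨ ℕP.+-assoc (r ℕ.* N) _ _ ⟩
  r ℕ.* N + (walks r j + walks r (suc j))  ≡⟨ cong (λ n → r ℕ.* N + n) (ℕP.+-comm (walks r j) _) ⟩
  r ℕ.* N + (walks r (suc j) + walks r j)  ≡⟨ cong (λ n → r ℕ.* N + n) (walks-step r j) ⟩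
  r ℕ.* N + N                              ≡⟨ ℕP.+-comm (r ℕ.* N) N ⟩
  suc r ℕ.* N                              ∎
  where
  open ≡-Reasoning
  N : ℕ
  N = suc r ℕ.^ suc j

Walk : {A : Set} (j : ℕ) → A → A → (Fin j → A) → Set
Walk zero    a b g = b ≢ a
Walk (suc j) a b g = g Fin.zero ≢ a × Walk j (g Fin.zero) b (g ∘ Fin.suc)

walk? : DecidableEquality A → ∀ j (a b : A) → Decidable (Walk j a b)
walk? _≟_ zero    a b g = ¬? (b ≟ a)
walk? _≟_ (suc j) a b g = ¬? (g Fin.zero ≟ a) ×-dec walk? _≟_ j (g Fin.zero) b (g ∘ Fin.suc)

walk-ext : ∀ j (a b : A) → Extensional (Walk j a b)
walk-ext zero    a b c≗c' w       = w
walk-ext (suc j) a b c≗c' (p , w) =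
  p ∘ trans (c≗c' Fin.zero) ,
  subst (λ x → Walk j x _ _) (c≗c' Fin.zero) (walk-ext j _ b (c≗c' ∘ Fin.suc) w)

module CompleteGraph (_≟_ : DecidableEquality A) (xs : List A) where

  walkCount : ℕ → A → A → ℕ
  walkCount j a b = count (walk? _≟_ j a b) (allFuns xs j)

  total : ℕ → A → ℕ
  total j b = sum (map (λ x → walkCount j x b) xs)

  walkCount-suc : ∀ j a b → walkCount (suc j) a b ≡ sum (map (λ x → indicator (¬? (x ≟ a)) ℕ.* walkCount j x b) xs)
  walkCount-suc j a b =
    trans (count-allFuns-suc (walk? _≟_ (suc j) a b) (walk-ext (suc j) a b) xs)
          (cong sum (ListP.map-cong (λ x → count-× (¬? (x ≟ a)) (walk? _≟_ j x b) (allFuns xs j)) xs))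

  walkCount-zero : ∀ a b → walkCount 0 a b + indicator (a ≟ b) ≡ 1
  walkCount-zero a b with a ≟ b | b ≟ a
  ... | yes _    | yes _    = refl
  ... | yes refl | no  b≢a  = ⊥-elim (b≢a refl)
  ... | no  a≢b  | yes refl = ⊥-elim (a≢b refl)
  ... | no  _    | no  _    = refl

  module _ (r : ℕ) (size : length xs ≡ suc (suc r)) (once : ∀ a → count (_≟ a) xs ≡ 1) where

    walkCount-step : ∀ j a b → walkCount (suc j) a b + walkCount j a b ≡ total j b
    walkCount-step j a b = begin
      walkCount (suc j) a b + walkCount j a b         ≡⟨ cong₂ _+_ (walkCount-suc j a b) (sym (ℕP.+-identityʳ (walkCount j a b))) ⟩
      others + 1 ℕ.* walkCount j a b                  ≡⟨ ℕP.+-comm others (1 ℕ.* walkCount j a b) ⟩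
      1 ℕ.* walkCount j a b + others                  ≡⟨ cong (λ n → n ℕ.* walkCount j a b + others) (sym (once a)) ⟩
      count (_≟ a) xs ℕ.* walkCount j a b + others    ≡⟨ sum-except _≟_ (λ x → walkCount j x b) a xs ⟩
      total j b                                       ∎
      where
      open ≡-Reasoning
      others : ℕ
      others = sum (map (λ x → indicator (¬? (x ≟ a)) ℕ.* walkCount j x b) xs)

    total-zero : ∀ b → total 0 b + 1 ≡ suc (suc r)
    total-zero b = begin
      total 0 b + 1                                              ≡⟨ cong (λ n → total 0 b + n) (sym (once b)) ⟩
      total 0 b + count (_≟ b) xs                                ≡⟨ cong (λ n → total 0 b + n) (sym (sum-indicator (_≟ b) xs)) ⟩
      total 0 b + sum (map (λ x → indicator (x ≟ b)) xs)         ≡⟨ sym (sum-map-+ (λ x → walkCount 0 x b) (λ x → indicator (x ≟ b)) xs) ⟩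
      sum (map (λ x → walkCount 0 x b + indicator (x ≟ b)) xs)   ≡⟨ cong sum (ListP.map-cong (λ x → walkCount-zero x b) xs) ⟩
      sum (map (λ _ → 1) xs)                                     ≡⟨ sum-const 1 xs ⟩
      length xs ℕ.* 1                                            ≡⟨ cong (ℕ._* 1) size ⟩
      suc (suc r) ℕ.* 1                                          ≡⟨ ℕP.*-identityʳ (suc (suc r)) ⟩
      suc (suc r)                                                ∎
      where open ≡-Reasoning

    total-step : ∀ j b → total (suc j) b + total j b ≡ suc (suc r) ℕ.* total j b
    total-step j b = begin
      total (suc j) b + total j b                                       ≡⟨ sym (sum-map-+ (λ x → walkCount (suc j) x b) (λ x → walkCount j x b) xs) ⟩
      sum (map (λ x → walkCount (suc j) x b + walkCount j x b) xs)     ≡⟨ cong sum (ListP.map-cong (λ x → walkCount-step j x b) xs) ⟩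
      sum (map (λ _ → total j b) xs)                                    ≡⟨ sum-const (total j b) xs ⟩
      length xs ℕ.* total j b                                           ≡⟨ cong (ℕ._* total j b) size ⟩
      suc (suc r) ℕ.* total j b                                         ∎
      where open ≡-Reasoning

    -- every walk prefix can be extended in r + 1 ways
    total-closed : ∀ j b → total j b ≡ suc r ℕ.^ suc j
    total-closed zero    b = ℕP.+-cancelʳ-≡ 1 _ _ (trans (total-zero b)
                               (sym (trans (cong (ℕ._+ 1) (ℕP.*-identityʳ (suc r))) (ℕP.+-comm (suc r) 1))))
    total-closed (suc j) b = ℕP.+-cancelʳ-≡ (total j b) _ _ (begin
      total (suc j) b + total j b          ≡⟨ total-step j b ⟩
      total j b + suc r ℕ.* total j b      ≡⟨ ℕP.+-comm (total j b) _ ⟩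
      suc r ℕ.* total j b + total j b      ≡⟨ cong (λ n → suc r ℕ.* n + total j b) (total-closed j b) ⟩
      suc r ℕ.^ suc (suc j) + total j b    ∎)
      where open ≡-Reasoning

    walkCount-closed : ∀ j a b → b ≢ a → walkCount j a b ≡ walks r j
    walkCount-closed j a b b≢a = step-unique ℕP.+-cancelʳ-≡ (λ i → walkCount i a b) (walks r) base step j
      where
      base : walkCount 0 a b ≡ 1
      base with a ≟ b | walkCount-zero a b
      ... | yes refl | _  = ⊥-elim (b≢a refl)
      ... | no _     | eq = trans (sym (ℕP.+-identityʳ (walkCount 0 a b))) eq
      step : ∀ i → walkCount (suc i) a b + walkCount i a b ≡ walks r (suc i) + walks r i
      step i = trans (walkCount-step i a b) (trans (total-closed i b) (sym (walks-step r i)))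

allFin-suc : ∀ n → allFin (suc n) ≡ Fin.zero ∷ map Fin.suc (allFin n)
allFin-suc n = cong (Fin.zero ∷_) (sym (ListP.map-tabulate id Fin.suc))

allFin-once : ∀ n (i : Fin n) → count (FinP._≟ i) (allFin n) ≡ 1
allFin-once (suc n) Fin.zero    = trans (cong (count (FinP._≟ Fin.zero)) (allFin-suc n))
  (cong suc (count-map-outside FinP._≟_ FinP._≟_ Fin.suc Fin.zero (λ _ ()) (allFin n)))
allFin-once (suc n) (Fin.suc i) = trans (cong (count (FinP._≟ Fin.suc i)) (allFin-suc n))
  (trans (count-map-injective FinP._≟_ FinP._≟_ Fin.suc FinP.suc-injective i (allFin n)) (allFin-once n i))

_≟ᶜ_ : ∀ {k} → DecidableEquality (Colour k)
_≟ᶜ_ = ≡-dec BoolP._≟_ FinP._≟_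

colourValue-injective : ∀ {k} {a b : Colour k} → colourValue a ≡ colourValue b → a ≡ b
colourValue-injective {a = true  , i} {true  , j} eq =
  cong (true ,_) (FinP.toℕ-injective (ℕP.suc-injective (ℤP.+-injective eq)))
colourValue-injective {a = false , i} {false , j} eq =
  cong (false ,_) (FinP.toℕ-injective (ℕP.suc-injective (ℤP.+-injective (ℤP.neg-injective eq))))
colourValue-injective {a = true  , i} {false , j} ()
colourValue-injective {a = false , i} {true  , j} ()

allColours-once : ∀ k (a : Colour k) → count (_≟ᶜ a) (allColours k) ≡ 1
allColours-once k (true , i) =
  trans (count-++ (_≟ᶜ (true , i)) (map (true ,_) (allFin k)) (map (false ,_) (allFin k)))
        (cong₂ _+_ (trans (count-map-injective FinP._≟_ _≟ᶜ_ (true ,_) ,-injectiveʳ i (allFin k)) (allFin-once k i))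
                   (count-map-outside FinP._≟_ _≟ᶜ_ (false ,_) (true , i) (λ _ ()) (allFin k)))
allColours-once k (false , i) =
  trans (count-++ (_≟ᶜ (false , i)) (map (true ,_) (allFin k)) (map (false ,_) (allFin k)))
        (cong₂ _+_ (count-map-outside FinP._≟_ _≟ᶜ_ (true ,_) (false , i) (λ _ ()) (allFin k))
                   (trans (count-map-injective FinP._≟_ _≟ᶜ_ (false ,_) ,-injectiveʳ i (allFin k)) (allFin-once k i)))

length-allColours : ∀ k → length (allColours k) ≡ k + k
length-allColours k =
  trans (ListP.length-++ (map tagTrue (allFin k)))
        (cong₂ _+_ (trans (ListP.length-map tagTrue (allFin k)) (ListP.length-tabulate {n = k} id))
                   (trans (ListP.length-map tagFalse (allFin k)) (ListP.length-tabulate {n = k} id)))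
  where
  tagTrue tagFalse : Fin k → Colour k
  tagTrue  = true ,_
  tagFalse = false ,_

module _ {k : ℕ} where

  -- the two edges of C₂⁻ say exactly that c(v) ≠ ±c(u)
  _≢±_ : Colour k → Colour k → Set
  a ≢± b = (colourValue b ≢ colourValue a) × (colourValue b ≢ ℤ.- colourValue a)

  _≢±?_ : ∀ a b → Dec (a ≢± b)
  a ≢±? b = ¬? (colourValue b ℤ.≟ colourValue a) ×-dec ¬? (colourValue b ℤ.≟ ℤ.- colourValue a)

  proper-ext : (G : SignedGraph) → Extensional (Proper {k} G)
  proper-ext G c≗c' = All.map λ { {x , y , s} p eq →
    p (trans (cong colourValue (c≗c' y)) (trans eq (cong (signAct s ∘ colourValue) (sym (c≗c' x))))) }

  positive-edge : ∀ {n} (c : Fin n → Colour k) x y → ProperAt c (x , y , pos) ⇔ (c y ≢ c x)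
  positive-edge c x y = mk⇔ (λ p → p ∘ cong colourValue) (λ c≢ → c≢ ∘ colourValue-injective)

  C2⁻-proper : ∀ a b → (λ (g : Fin 0 → Colour k) → Proper C2⁻ (a ∷ᶠ b ∷ᶠ g)) ≐ (λ _ → (a ≢± b) × ⊤)
  C2⁻-proper a b = (λ { (p ∷ q ∷ []) → (p , q) , tt }) , (λ { ((p , q) , tt) → p ∷ q ∷ [] })

pathEdge : (j : ℕ) → ℕ → Fin (2 + j) × Fin (2 + j) × Sign
pathEdge j i = pathVertex j i , pathVertex j (suc i) , pos

pathVertex-inner : ∀ j i (i<j : i < j) → pathVertex j (suc i) ≡ Fin.suc (Fin.suc (fromℕ< i<j))
pathVertex-inner j i i<j with i <? j
... | yes _   = refl
... | no i≮j = ⊥-elim (i≮j i<j)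

pathVertex-last : ∀ j i → ¬ i < j → pathVertex j (suc i) ≡ Fin.suc Fin.zero
pathVertex-last j i i≮j with i <? j
... | yes i<j = ⊥-elim (i≮j i<j)
... | no _    = refl

-- Lengthening the path by one vertex: the path of B_{j+3}^1 with its first edge
-- removed is the path of B_{j+2}^1 relabelled by `tailVertex` (u ↦ u₁, v ↦ v, u_i ↦ u_{i+1}).
tailVertex : ∀ {j} → Fin (2 + j) → Fin (3 + j)
tailVertex Fin.zero                 = Fin.suc (Fin.suc Fin.zero)
tailVertex (Fin.suc Fin.zero)       = Fin.suc Fin.zero
tailVertex (Fin.suc (Fin.suc i))    = Fin.suc (Fin.suc (Fin.suc i))

pathVertex-tail : ∀ j i → pathVertex (suc j) (suc i) ≡ tailVertex (pathVertex j i)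
pathVertex-tail j zero    = refl
pathVertex-tail j (suc i) = byCases (i <? j)
  where
  byCases : Dec (i < j) → pathVertex (suc j) (suc (suc i)) ≡ tailVertex (pathVertex j (suc i))
  byCases (yes i<j) = trans (pathVertex-inner (suc j) (suc i) (s≤s i<j))
                            (cong tailVertex (sym (pathVertex-inner j i i<j)))
  byCases (no i≮j)  = trans (pathVertex-last (suc j) (suc i) (i≮j ∘ ℕP.≤-pred))
                            (cong tailVertex (sym (pathVertex-last j i i≮j)))

pathEdge-tail : ∀ {k} j i (c : Fin (3 + j) → Colour k) →
                ProperAt c (pathEdge (suc j) (suc i)) ≡ ProperAt (c ∘ tailVertex) (pathEdge j i)
pathEdge-tail j i c rewrite pathVertex-tail j i | pathVertex-tail j (suc i) = refl

pathEdges-suc : ∀ j → pathEdges (suc j) ≡ pathEdge (suc j) 0 ∷ map (pathEdge (suc j) ∘ suc) (upTo (suc j))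
pathEdges-suc j = map-upTo-suc (pathEdge (suc j)) (suc j)

All-map-≡ : {C : Set} {P : Pred B 0ℓ} {Q : Pred C 0ℓ} (f : A → B) (g : A → C) →
            (∀ x → P (f x) ≡ Q (g x)) → (xs : List A) → All P (map f xs) ⇔ All Q (map g xs)
All-map-≡ f g P≡Q xs = mk⇔ (AllP.map⁺ ∘ All.map (λ {x} → subst id (P≡Q x)) ∘ AllP.map⁻)
                           (AllP.map⁺ ∘ All.map (λ {x} → subst id (sym (P≡Q x))) ∘ AllP.map⁻)

path-walk : ∀ {k} j (c : Fin (2 + j) → Colour k) →
            All (ProperAt c) (pathEdges j) ⇔ Walk j (c Fin.zero) (c (Fin.suc Fin.zero)) (c ∘ Fin.suc ∘ Fin.suc)
path-walk zero    c = mk⇔ (λ { (p ∷ []) → to (positive-edge c _ _) p }) (λ w → from (positive-edge c _ _) w ∷ [])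
path-walk (suc j) c rewrite pathEdges-suc j = mk⇔
  (λ { (p ∷ ps) → to (positive-edge c _ _) p , to (path-walk j (c ∘ tailVertex)) (to rest ps) })
  (λ { (p , w) → from (positive-edge c _ _) p ∷ from rest (from (path-walk j (c ∘ tailVertex)) w) })
  where
  rest : All (ProperAt c) (map (pathEdge (suc j) ∘ suc) (upTo (suc j))) ⇔ All (ProperAt (c ∘ tailVertex)) (pathEdges j)
  rest = All-map-≡ (pathEdge (suc j) ∘ suc) (pathEdge j) (λ i → pathEdge-tail j i c) (upTo (suc j))

B1-proper : ∀ {k} j (a b : Colour k) →
            (λ g → Proper (B1 j) (a ∷ᶠ b ∷ᶠ g)) ≐ (λ g → (a ≢± b) × Walk j a b g)
B1-proper j a b = (λ { (p ∷ q ∷ ps) → (p , q) , to (path-walk j (a ∷ᶠ b ∷ᶠ _)) ps })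
                , (λ { ((p , q) , w) → p ∷ q ∷ from (path-walk j (a ∷ᶠ b ∷ᶠ _)) w })

module Chromatic (k : ℕ) where
  open CompleteGraph (_≟ᶜ_ {k}) (allColours k)

  colours : List (Colour k)
  colours = allColours k

  χ-C2⁻ : balancedChrom C2⁻ k ≡ sum (map (λ a → sum (map (λ b → indicator (a ≢±? b) ℕ.* 1) colours)) colours)
  χ-C2⁻ = count-allFuns-2+ (proper? C2⁻) (proper-ext C2⁻) _≢±?_ (λ _ _ _ → yes tt) C2⁻-proper colours

  χ-B1 : ∀ j → balancedChrom (B1 j) k ≡ sum (map (λ a → sum (map (λ b → indicator (a ≢±? b) ℕ.* walkCount j a b) colours)) colours)
  χ-B1 j = count-allFuns-2+ (proper? (B1 j)) (proper-ext (B1 j)) _≢±?_ (walk? _≟ᶜ_ j) (B1-proper j) colours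

  χ-B1-factor : ∀ j D → (∀ a b → a ≢± b → walkCount j a b ≡ D) → balancedChrom (B1 j) k ≡ balancedChrom C2⁻ k ℕ.* D
  χ-B1-factor j D walks≡D = begin
    balancedChrom (B1 j) k
      ≡⟨ χ-B1 j ⟩
    sum (map (λ a → sum (map (λ b → indicator (a ≢±? b) ℕ.* walkCount j a b) colours)) colours)
      ≡⟨ cong sum (ListP.map-cong (λ a → cong sum (ListP.map-cong (termwise a) colours)) colours) ⟩
    sum (map (λ a → sum (map (λ b → indicator (a ≢±? b) ℕ.* 1 ℕ.* D) colours)) colours)
      ≡⟨ cong sum (ListP.map-cong (λ a → sum-map-*ʳ (λ b → indicator (a ≢±? b) ℕ.* 1) D colours) colours) ⟩
    sum (map (λ a → sum (map (λ b → indicator (a ≢±? b) ℕ.* 1) colours) ℕ.* D) colours)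
      ≡⟨ sum-map-*ʳ (λ a → sum (map (λ b → indicator (a ≢±? b) ℕ.* 1) colours)) D colours ⟩
    sum (map (λ a → sum (map (λ b → indicator (a ≢±? b) ℕ.* 1) colours)) colours) ℕ.* D
      ≡⟨ cong (ℕ._* D) (sym χ-C2⁻) ⟩
    balancedChrom C2⁻ k ℕ.* D ∎
    where
    open ≡-Reasoning
    termwise : ∀ a b → indicator (a ≢±? b) ℕ.* walkCount j a b ≡ indicator (a ≢±? b) ℕ.* 1 ℕ.* D
    termwise a b with a ≢±? b
    ... | yes a≢±b = cong (ℕ._+ 0) (walks≡D a b a≢±b)
    ... | no _     = refl

-- Alternating sums  Σ_{i=0}^{N} (-1)^i x^{N-i}  satisfy
-- S(N+1) + S(N) = x^{N+1}, the same difference equation as `walks`.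

sumℤ : List ℤ → ℤ
sumℤ = foldr ℤ._+_ (+ 0)

sumℤ-neg : (ys : List ℤ) → sumℤ (map ℤ.-_ ys) ≡ ℤ.- sumℤ ys
sumℤ-neg []       = refl
sumℤ-neg (y ∷ ys) = trans (cong (ℤ._+_ (ℤ.- y)) (sumℤ-neg ys)) (sym (ℤP.neg-distrib-+ y (sumℤ ys)))

alternatingSum : ℤ → ℕ → ℤ
alternatingSum x N = sumℤ (map (λ i → (ℤ.- (+ 1)) ℤ.^ i ℤ.* (x ℤ.^ (N ∸ i))) (upTo (suc N)))

alternatingSum-suc : ∀ x N → alternatingSum x (suc N) ≡ x ℤ.^ suc N ℤ.- alternatingSum x N
alternatingSum-suc x N = begin
  alternatingSum x (suc N)
    ≡⟨ cong sumℤ (map-upTo-suc term′ (suc N)) ⟩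
  term′ 0 ℤ.+ sumℤ (map (term′ ∘ suc) (upTo (suc N)))
    ≡⟨ cong₂ ℤ._+_ (ℤP.*-identityˡ (x ℤ.^ suc N)) (cong sumℤ (ListP.map-cong negated (upTo (suc N)))) ⟩
  x ℤ.^ suc N ℤ.+ sumℤ (map (ℤ.-_ ∘ term) (upTo (suc N)))
    ≡⟨ cong (λ s → x ℤ.^ suc N ℤ.+ sumℤ s) (ListP.map-∘ {g = ℤ.-_} {f = term} (upTo (suc N))) ⟩
  x ℤ.^ suc N ℤ.+ sumℤ (map ℤ.-_ (map term (upTo (suc N))))
    ≡⟨ cong (ℤ._+_ (x ℤ.^ suc N)) (sumℤ-neg (map term (upTo (suc N)))) ⟩
  x ℤ.^ suc N ℤ.- alternatingSum x N ∎
  where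
  open ≡-Reasoning
  term term′ : ℕ → ℤ
  term  i = (ℤ.- (+ 1)) ℤ.^ i ℤ.* (x ℤ.^ (N ∸ i))
  term′ i = (ℤ.- (+ 1)) ℤ.^ i ℤ.* (x ℤ.^ (suc N ∸ i))
  negated : ∀ i → term′ (suc i) ≡ ℤ.- term i
  negated i = trans (ℤP.*-assoc (ℤ.- (+ 1)) ((ℤ.- (+ 1)) ℤ.^ i) (x ℤ.^ (N ∸ i))) (ℤP.-1*i≡-i (term i))

alternatingSum-step : ∀ x N → alternatingSum x (suc N) ℤ.+ alternatingSum x N ≡ x ℤ.^ suc N
alternatingSum-step x N =
  trans (cong (ℤ._+ alternatingSum x N) (alternatingSum-suc x N)) (ℤ+.//-rightDividesˡ (alternatingSum x N) (x ℤ.^ suc N))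

pos-^ : ∀ n m → + (n ℕ.^ m) ≡ (+ n) ℤ.^ m
pos-^ n zero    = refl
pos-^ n (suc m) = trans (ℤP.pos-* n (n ℕ.^ m)) (cong (ℤ._*_ (+ n)) (pos-^ n m))

walks≡alternatingSum : ∀ r j → + walks r j ≡ alternatingSum (+ suc r) j
walks≡alternatingSum r = step-unique ℤ+.∙-cancelʳ (λ j → + walks r j) (alternatingSum (+ suc r)) refl step
  where
  step : ∀ j → + walks r (suc j) ℤ.+ + walks r j ≡ alternatingSum (+ suc r) (suc j) ℤ.+ alternatingSum (+ suc r) j
  step j = begin
    + walks r (suc j) ℤ.+ + walks r j    ≡⟨ ℤP.pos-+ (walks r (suc j)) (walks r j) ⟨
    + (walks r (suc j) + walks r j)      ≡⟨ cong +_ (walks-step r j) ⟩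
    + (suc r ℕ.^ suc j)                  ≡⟨ pos-^ (suc r) (suc j) ⟩
    (+ suc r) ℤ.^ suc j                  ≡⟨ alternatingSum-step (+ suc r) j ⟨
    alternatingSum (+ suc r) (suc j) ℤ.+ alternatingSum (+ suc r) j ∎
    where open ≡-Reasoning

-- With k + 1 colour pairs the colour graph is complete on (k + k) + 2 vertices.
colour-walks : ∀ k j (a b : Colour (suc k)) → b ≢ a →
               CompleteGraph.walkCount _≟ᶜ_ (allColours (suc k)) j a b ≡ walks (k + k) j
colour-walks k = CompleteGraph.walkCount-closed _≟ᶜ_ (allColours (suc k)) (k + k) size (allColours-once (suc k))
  where
  size : length (allColours (suc k)) ≡ suc (suc (k + k))
  size = trans (length-allColours (suc k)) (cong suc (ℕP.+-suc k k))

two-colours-less-one : ∀ k → + (2 ℕ.* suc k) ℤ.- + 1 ≡ + suc (k + k)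
two-colours-less-one k = cong +_ (trans (ℕP.+-suc k (k + 0)) (cong (λ n → suc (k + n)) (ℕP.+-identityʳ k)))

lemma7p4 : (m k : ℕ) → m ≥ 2 → k ≥ 1 →
    + balancedChrom B[ m ]¹ k ≡ altSum k (m ∸ 2) * + balancedChrom C2⁻ k
lemma7p4 zero          _       ()          _
lemma7p4 (suc zero)    _       (s≤s ())    _
lemma7p4 (suc (suc j)) zero    _           ()
lemma7p4 (suc (suc j)) (suc k) _           _  = begin
  + balancedChrom (B1 j) (suc k)              ≡⟨ cong +_ (χ-B1-factor j (walks (k + k) j) walkCounts) ⟩
  + (χC2 ℕ.* walks (k + k) j)                 ≡⟨ ℤP.pos-* χC2 (walks (k + k) j) ⟩
  + χC2 * + walks (k + k) j                   ≡⟨ ℤP.*-comm (+ χC2) _ ⟩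
  + walks (k + k) j * + χC2                   ≡⟨ cong (_* + χC2) (walks≡alternatingSum (k + k) j) ⟩
  alternatingSum (+ suc (k + k)) j * + χC2    ≡⟨ cong (λ x → alternatingSum x j * + χC2) (two-colours-less-one k) ⟨
  altSum (suc k) j * + χC2                    ∎
  where
  open ≡-Reasoning
  open Chromatic (suc k)
  χC2 : ℕ
  χC2 = balancedChrom C2⁻ (suc k)
  walkCounts : ∀ a b → a ≢± b → CompleteGraph.walkCount _≟ᶜ_ (allColours (suc k)) j a b ≡ walks (k + k) j
  walkCounts a b a≢±b = colour-walks k j a b (proj₁ a≢±b ∘ cong colourValue)
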